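{- For a nonprincipal ultrafilter $\mathcal U$ on $\mathbb N$ the following are equivalent: (1) $\mathcal U$ is quasi-selective; (2) every function $f:\mathbb N\to\mathbb N$ of polynomial growth is $\mathcal U$-equivalent to a nondecreasing function; (3) every function $f:\mathbb N\to\mathbb N$ with minimal steps is $\mathcal U$-equivalent to a nondecreasing function.
   Context: $\mathbb N=\{0,1,2,\dots\}$. $f\equiv_{\mathcal U}g$ means $\{n: f(n)=g(n)\}\in\mathcal U$. A nonprincipal ultrafilter $\mathcal U$ on $\mathbb N$ is quasi-selective if every $f:\mathbb N\to\mathbb N$ with $f(n)\le n$ for all $n$ is $\mathcal U$-equivalent to a nondecreasing function. A function $f:\mathbb N\to\mathbb N$ has polynomial growth if there are $k,m$ such that $f(n)\le n^k$ for all $n>m$. A function $f:\mathbb N\to\mathbb N$ has minimal steps if $|f(n+1)-f(n)|\le 1$ for all $n$. -}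

module Defs where

open import Data.Nat using (ℕ; suc; _≤_; _<_; _^_; ∣_-_∣)
open import Data.Product using (Σ; ∃; _×_)
open import Data.Sum using (_⊎_)
open import Data.Unit using (⊤)
open import Data.Empty using (⊥)
open import Relation.Nullary using (¬_)
open import Relation.Binary.PropositionalEquality using (_≡_)

record IsUltrafilter (U : (ℕ → Set) → Set) : Set₁ where
  field
    whole    : U (λ _ → ⊤)
    proper   : ¬ U (λ _ → ⊥)
    upward   : ∀ {A B : ℕ → Set} → (∀ n → A n → B n) → U A → U B
    meet     : ∀ {A B : ℕ → Set} → U A → U B → U (λ n → A n × B n)
    ultra    : ∀ (A : ℕ → Set) → U A ⊎ U (λ n → ¬ A n)

IsNonprincipal : ((ℕ → Set) → Set) → Set
IsNonprincipal U = ∀ k → ¬ U (λ n → n ≡ k)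

_≡[_]_ : (ℕ → ℕ) → ((ℕ → Set) → Set) → (ℕ → ℕ) → Set
f ≡[ U ] g = U (λ n → f n ≡ g n)

Nondecreasing : (ℕ → ℕ) → Set
Nondecreasing g = ∀ m n → m ≤ n → g m ≤ g n

EquivToNondecreasing : ((ℕ → Set) → Set) → (ℕ → ℕ) → Set
EquivToNondecreasing U f = Σ (ℕ → ℕ) λ g → Nondecreasing g × (f ≡[ U ] g)

QuasiSelective : ((ℕ → Set) → Set) → Set
QuasiSelective U = ∀ (f : ℕ → ℕ) → (∀ n → f n ≤ n) → EquivToNondecreasing U f

PolynomialGrowth : (ℕ → ℕ) → Set
PolynomialGrowth f = Σ ℕ λ k → Σ ℕ λ m → ∀ n → m < n → f n ≤ n ^ k

MinimalSteps : (ℕ → ℕ) → Set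
MinimalSteps f = ∀ n → ∣ f (suc n) - f n ∣ ≤ 1

-- (1) ⇒ (2): write f n in base n + 1. Every digit is at most n, so quasi-selectivity makes each
-- digit, and then f, U-equivalent to a nondecreasing function; a function below n ^ k agrees
-- cofinitely with its residue modulo (n + 1) ^ (k + 1), which has boundedly many digits.
-- A function with minimal steps grows at most linearly, so (1) ⇒ (3) follows.
--
-- (3) ⇒ (1): cut ℕ into consecutive runs of Fibonacci lengths and colour run i by i mod 3; U
-- contains the union of the runs of some colour r. The two runs between consecutive runs of
-- colour r have together exactly the length of the next one, so any values prescribed with unit
-- steps on the runs of colour r, and jumping by at most that length, extend to a function with
-- minimal steps: in the gaps, walk towards the next prescribed value. Prescribing a profile that
-- strictly decreases along each run, (3) yields a set in U meeting every run at most once.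
-- Prescribing next on each run the value of f / 3 at its point of that set (small enough, as
-- f n ≤ n < 3 · fib (run n)), (3) makes f / 3 U-equivalent to a nondecreasing function; and
-- f mod 3 is U-constant.

module Submission where

open import Defs
open import Data.Nat
open import Data.Nat.Properties
open import Data.Nat.DivMod
open import Data.Product using (_×_; _,_; proj₁; proj₂; ∃)
open import Data.Sum using (_⊎_; inj₁; inj₂)
open import Data.Unit using (⊤)
open import Data.Empty using (⊥-elim)
open import Relation.Nullary using (¬_; yes; no; Dec)
open import Relation.Nullary.Decidable using (_×-dec_)
open import Relation.Binary.PropositionalEquality
open import Relation.Binary.Definitions using (tri<; tri≈; tri>)
open import Function.Base using (_∘_)
open import Function.Bundles using (_⇔_; mk⇔)

step : ℕ → ℕ → ℕ
step zero    zero    = 0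
step zero    (suc t) = 1
step (suc a) zero    = a
step (suc a) (suc t) = suc (step a t)

step-moves-≤1 : ∀ a t → ∣ step a t - a ∣ ≤ 1
step-moves-≤1 zero          zero    = z≤n
step-moves-≤1 zero          (suc t) = ≤-refl
step-moves-≤1 (suc zero)    zero    = ≤-refl
step-moves-≤1 (suc (suc a)) zero    = step-moves-≤1 (suc a) zero
step-moves-≤1 (suc a)       (suc t) = step-moves-≤1 a t

step-approaches : ∀ a t → ∣ step a t - t ∣ ≡ ∣ a - t ∣ ∸ 1
step-approaches zero    zero    = refl
step-approaches zero    (suc t) = refl
step-approaches (suc a) zero    = ∣-∣-identityʳ a
step-approaches (suc a) (suc t) = step-approaches a t

step-reaches : ∀ a t → ∣ t - a ∣ ≤ 1 → step a t ≡ t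
step-reaches a t close = ∣m-n∣≡0⇒m≡n (trans (step-approaches a t)
  (m≤n⇒m∸n≡0 (subst (_≤ 1) (∣-∣-comm t a) close)))

pursuit : (ℕ → ℕ) → ℕ → ℕ
pursuit tg zero    = tg 0
pursuit tg (suc n) = step (pursuit tg n) (tg (suc n))

pursuit-minimalSteps : ∀ tg → MinimalSteps (pursuit tg)
pursuit-minimalSteps tg n = step-moves-≤1 (pursuit tg n) (tg (suc n))

pursuit-approaches : ∀ tg {t} a d → (∀ k → k < d → tg (suc (a + k)) ≡ t) →
                     ∣ pursuit tg (a + d) - t ∣ ≤ ∣ pursuit tg a - t ∣ ∸ d
pursuit-approaches tg {t} a zero _ = ≤-reflexive (cong (λ n → ∣ pursuit tg n - t ∣) (+-identityʳ a))
pursuit-approaches tg {t} a (suc d) constant = begin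
  ∣ pursuit tg (a + suc d) - t ∣                        ≡⟨ cong (λ n → ∣ pursuit tg n - t ∣) (+-suc a d) ⟩
  ∣ step (pursuit tg (a + d)) (tg (suc (a + d))) - t ∣  ≡⟨ cong (λ x → ∣ step (pursuit tg (a + d)) x - t ∣) (constant d ≤-refl) ⟩
  ∣ step (pursuit tg (a + d)) t - t ∣                   ≡⟨ step-approaches (pursuit tg (a + d)) t ⟩
  ∣ pursuit tg (a + d) - t ∣ ∸ 1                        ≤⟨ ∸-monoˡ-≤ 1 (pursuit-approaches tg a d (λ k k<d → constant k (m<n⇒m<1+n k<d))) ⟩
  ∣ pursuit tg a - t ∣ ∸ d ∸ 1                          ≡⟨ ∸-+-assoc _ d 1 ⟩
  ∣ pursuit tg a - t ∣ ∸ (d + 1)                        ≡⟨ cong (∣ pursuit tg a - t ∣ ∸_) (+-comm d 1) ⟩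
  ∣ pursuit tg a - t ∣ ∸ suc d                          ∎
  where open ≤-Reasoning

pursuit-reaches : ∀ tg {t} a d → (∀ k → k < d → tg (suc (a + k)) ≡ t) →
                  ∣ pursuit tg a - t ∣ ≤ d → pursuit tg (a + d) ≡ t
pursuit-reaches tg a d constant near = ∣m-n∣≡0⇒m≡n (n≤0⇒n≡0
  (≤-trans (pursuit-approaches tg a d constant) (≤-reflexive (m≤n⇒m∸n≡0 near))))

pursuit-tracks : ∀ tg a m → pursuit tg a ≡ tg a →
                 (∀ k → suc k < m → ∣ tg (suc (a + k)) - tg (a + k) ∣ ≤ 1) →
                 ∀ k → k < m → pursuit tg (a + k) ≡ tg (a + k)
pursuit-tracks tg a m at-a _ zero _ =
  subst (λ n → pursuit tg n ≡ tg n) (sym (+-identityʳ a)) at-a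
pursuit-tracks tg a m at-a unit (suc k) k<m =
  subst (λ n → pursuit tg n ≡ tg n) (sym (+-suc a k))
    (trans (cong (λ x → step x (tg (suc (a + k)))) (pursuit-tracks tg a m at-a unit k (<-trans (n<1+n k) k<m)))
           (step-reaches (tg (a + k)) (tg (suc (a + k))) (unit k k<m)))

minimalSteps⇒polynomialGrowth : ∀ f → MinimalSteps f → PolynomialGrowth f
minimalSteps⇒polynomialGrowth f unit = 2 , f 0 , λ n f0<n → ≤-trans (f≤f0+id n) (+≤square (f 0) n f0<n)
  where
  f≤f0+id : ∀ n → f n ≤ f 0 + n
  f≤f0+id zero    = m≤m+n (f 0) 0
  f≤f0+id (suc n) = begin
    f (suc n)                    ≤⟨ m≤n+∣m-n∣ (f (suc n)) (f n) ⟩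
    f n + ∣ f (suc n) - f n ∣     ≤⟨ +-mono-≤ (f≤f0+id n) (unit n) ⟩
    f 0 + n + 1                  ≡⟨ trans (+-assoc (f 0) n 1) (cong (f 0 +_) (+-comm n 1)) ⟩
    f 0 + suc n                  ∎
    where open ≤-Reasoning
  +≤square : ∀ c n → c < n → c + n ≤ n ^ 2
  +≤square c (suc n) (s≤s c≤n) = begin
    c + suc n             ≤⟨ +-monoˡ-≤ (suc n) (≤-trans c≤n (m≤m*n n (suc n))) ⟩
    n * suc n + suc n     ≡⟨ +-comm (n * suc n) (suc n) ⟩
    suc n * suc n         ≡⟨ cong (suc n *_) (sym (*-identityʳ (suc n))) ⟩
    suc n ^ 2             ∎
    where open ≤-Reasoning

∣m∸1+n-m∸n∣≤1 : ∀ m n → ∣ m ∸ suc n - m ∸ n ∣ ≤ 1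
∣m∸1+n-m∸n∣≤1 zero    n       = subst (_≤ 1) (sym (0∸n≡0 n)) z≤n
∣m∸1+n-m∸n∣≤1 (suc m) zero    = ≤-reflexive (∣m-1+m∣≡1 m)
  where
  ∣m-1+m∣≡1 : ∀ m → ∣ m - suc m ∣ ≡ 1
  ∣m-1+m∣≡1 zero    = refl
  ∣m-1+m∣≡1 (suc m) = ∣m-1+m∣≡1 m
∣m∸1+n-m∸n∣≤1 (suc m) (suc n) = ∣m∸1+n-m∸n∣≤1 m n

colour : ℕ → ℕ
colour zero                = 0
colour (suc zero)          = 1
colour (suc (suc zero))    = 2
colour (suc (suc (suc i))) = colour i

colour≤2 : ∀ i → colour i ≤ 2
colour≤2 zero                = z≤n
colour≤2 (suc zero)          = s≤s z≤n
colour≤2 (suc (suc zero))    = ≤-refl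
colour≤2 (suc (suc (suc i))) = colour≤2 i

colour-suc≢ : ∀ i → colour (suc i) ≢ colour i
colour-suc≢ zero                ()
colour-suc≢ (suc zero)          ()
colour-suc≢ (suc (suc zero))    ()
colour-suc≢ (suc (suc (suc i))) = colour-suc≢ i

colour-2+≢ : ∀ i → colour (2 + i) ≢ colour i
colour-2+≢ zero                ()
colour-2+≢ (suc zero)          ()
colour-2+≢ (suc (suc zero))    ()
colour-2+≢ (suc (suc (suc i))) = colour-2+≢ i

m∸2≤n<m⇒m≡1+n∨m≡2+n : ∀ {m n} → m ∸ 2 ≤ n → n < m → m ≡ suc n ⊎ m ≡ 2 + n
m∸2≤n<m⇒m≡1+n∨m≡2+n {suc zero}    {zero}  _   _     = inj₁ refl
m∸2≤n<m⇒m≡1+n∨m≡2+n {suc zero}    {suc n} _   (s≤s ())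
m∸2≤n<m⇒m≡1+n∨m≡2+n {suc (suc m)} {n}     m≤n n<2+m with m≤n⇒m<n∨m≡n (s≤s⁻¹ n<2+m)
... | inj₂ refl  = inj₁ refl
... | inj₁ n<1+m = inj₂ (cong (2 +_) (≤-antisym m≤n (s≤s⁻¹ n<1+m)))

module Runs (len : ℕ → ℕ) (len-pos : ∀ i → 0 < len i) where

  runStart : ℕ → ℕ
  runStart zero    = 0
  runStart (suc i) = runStart i + len i

  suc-pred-len : ∀ i → suc (pred (len i)) ≡ len i
  suc-pred-len i = suc-pred (len i) {{>-nonZero (len-pos i)}}

  pred-len<len : ∀ i → pred (len i) < len i
  pred-len<len i = ≤-reflexive (suc-pred-len i)

  lastOfRun : ℕ → ℕ
  lastOfRun i = runStart i + pred (len i)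

  suc-lastOfRun : ∀ i → suc (lastOfRun i) ≡ runStart (suc i)
  suc-lastOfRun i = trans (sym (+-suc (runStart i) _)) (cong (runStart i +_) (suc-pred-len i))

  runStart-mono-≤ : ∀ {m n} → m ≤ n → runStart m ≤ runStart n
  runStart-mono-≤ {n = zero} z≤n = ≤-refl
  runStart-mono-≤ {m} {suc n} m≤1+n with m≤n⇒m<n∨m≡n m≤1+n
  ... | inj₂ refl  = ≤-refl
  ... | inj₁ m<1+n = ≤-trans (runStart-mono-≤ (s≤s⁻¹ m<1+n)) (m≤m+n (runStart n) (len n))

  advance : ℕ × ℕ → ℕ × ℕ
  advance (i , k) with suc k <? len i
  ... | yes _ = i , suc k
  ... | no _  = suc i , 0

  locate : ℕ → ℕ × ℕ
  locate zero    = 0 , 0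
  locate (suc n) = advance (locate n)

  run offset : ℕ → ℕ
  run n    = proj₁ (locate n)
  offset n = proj₂ (locate n)

  advance-within : ∀ i k → suc k < len i → advance (i , k) ≡ (i , suc k)
  advance-within i k within with suc k <? len i
  ... | yes _      = refl
  ... | no outside = ⊥-elim (outside within)

  advance-beyond : ∀ i k → ¬ suc k < len i → advance (i , k) ≡ (suc i , 0)
  advance-beyond i k outside with suc k <? len i
  ... | yes within = ⊥-elim (outside within)
  ... | no _       = refl

  locate-runStart+ : ∀ i k → k < len i → locate (runStart i + k) ≡ (i , k)
  locate-runStart+ zero zero _ = refl
  locate-runStart+ (suc i) zero _ = begin
    locate (runStart (suc i) + 0)   ≡⟨ cong locate (trans (+-identityʳ _) (sym (suc-lastOfRun i))) ⟩
    advance (locate (lastOfRun i))  ≡⟨ cong advance (locate-runStart+ i _ (pred-len<len i)) ⟩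
    advance (i , pred (len i))      ≡⟨ advance-beyond i _ (<-irrefl (suc-pred-len i)) ⟩
    (suc i , 0)                     ∎
    where open ≡-Reasoning
  locate-runStart+ i (suc k) k<len = begin
    locate (runStart i + suc k)        ≡⟨ cong locate (+-suc (runStart i) k) ⟩
    advance (locate (runStart i + k))  ≡⟨ cong advance (locate-runStart+ i k (<-trans (n<1+n k) k<len)) ⟩
    advance (i , k)                    ≡⟨ advance-within i k k<len ⟩
    (i , suc k)                        ∎
    where open ≡-Reasoning

  run-runStart+ : ∀ i k → k < len i → run (runStart i + k) ≡ i
  run-runStart+ i k k<len = cong proj₁ (locate-runStart+ i k k<len)

  locate-sound : ∀ n → runStart (run n) + offset n ≡ n × offset n < len (run n)
  locate-sound zero = refl , len-pos 0
  locate-sound (suc n) with locate n | locate-sound n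
  ... | i , k | start+k≡n , k<len with suc k <? len i
  ...   | yes within = trans (+-suc (runStart i) k) (cong suc start+k≡n) , within
  ...   | no outside = start+0≡1+n , len-pos (suc i)
    where
    start+0≡1+n : runStart (suc i) + 0 ≡ suc n
    start+0≡1+n = begin
      runStart i + len i + 0  ≡⟨ +-identityʳ _ ⟩
      runStart i + len i      ≡⟨ cong (runStart i +_) (≤-antisym k<len (≮⇒≥ outside)) ⟨
      runStart i + suc k      ≡⟨ +-suc (runStart i) k ⟩
      suc (runStart i + k)    ≡⟨ cong suc start+k≡n ⟩
      suc n                   ∎
      where open ≡-Reasoning

  run-between : ∀ {a b n} → runStart a ≤ n → n < runStart b → a ≤ run n × run n < b
  run-between {a} {b} {n} a≤n n<b = ≮⇒≥ run≮a , ≰⇒> b≰run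
    where
    n≡ : runStart (run n) + offset n ≡ n
    n≡ = proj₁ (locate-sound n)
    n<next : n < runStart (suc (run n))
    n<next = subst (_< runStart (suc (run n))) n≡ (+-monoʳ-< (runStart (run n)) (proj₂ (locate-sound n)))
    run≮a : ¬ run n < a
    run≮a run<a = <-irrefl refl (<-≤-trans n<next (≤-trans (runStart-mono-≤ run<a) a≤n))
    b≰run : ¬ b ≤ run n
    b≰run b≤run = <-irrefl refl (<-≤-trans n<b (≤-trans (runStart-mono-≤ b≤run)
                    (subst (runStart (run n) ≤_) n≡ (m≤m+n _ _))))

  module Interpolation
    (r : ℕ) (profile : ℕ → ℕ → ℕ)
    (profile-steps : ∀ i k → ∣ profile i (suc k) - profile i k ∣ ≤ 1)
    (profile-jump : ∀ j → colour j ≡ r →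
                    ∣ profile j (pred (len j)) - profile (3 + j) 0 ∣ ≤ len (1 + j) + len (2 + j))
    where

    runTarget : ℕ → ℕ → ℕ
    runTarget i k with colour i ≟ r | colour (suc i) ≟ r
    ... | yes _ | _     = profile i k
    ... | no _  | yes _ = profile (suc i) 0
    ... | no _  | no _  = profile (2 + i) 0

    target : ℕ → ℕ
    target n = runTarget (run n) (offset n)

    interpolant : ℕ → ℕ
    interpolant = pursuit target

    runTarget-coloured : ∀ i k → colour i ≡ r → runTarget i k ≡ profile i k
    runTarget-coloured i k coloured with colour i ≟ r
    ... | yes _        = refl
    ... | no ¬coloured = ⊥-elim (¬coloured coloured)

    runTarget-gap : ∀ i m k → colour i ≡ r → i ≡ suc m ⊎ i ≡ 2 + m → runTarget m k ≡ profile i 0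
    runTarget-gap .(suc m) m k coloured (inj₁ refl) with colour m ≟ r | colour (suc m) ≟ r
    ... | yes m-coloured | _            = ⊥-elim (colour-suc≢ m (trans coloured (sym m-coloured)))
    ... | no _           | yes _        = refl
    ... | no _           | no ¬coloured = ⊥-elim (¬coloured coloured)
    runTarget-gap .(2 + m) m k coloured (inj₂ refl) with colour m ≟ r | colour (suc m) ≟ r
    ... | yes m-coloured | _                = ⊥-elim (colour-2+≢ m (trans coloured (sym m-coloured)))
    ... | no _           | yes 1+m-coloured = ⊥-elim (colour-suc≢ (suc m) (trans coloured (sym 1+m-coloured)))
    ... | no _           | no _             = refl

    target-on-run : ∀ i k → colour i ≡ r → k < len i → target (runStart i + k) ≡ profile i k
    target-on-run i k coloured k<len =
      trans (cong (λ p → runTarget (proj₁ p) (proj₂ p)) (locate-runStart+ i k k<len))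
            (runTarget-coloured i k coloured)

    -- The target is constant on the gap after the previous run of colour r (run i - 3), up to and
    -- including the start of run i; for i < 3 the gap starts at 0.
    target-approach : ∀ i → colour i ≡ r → ∀ n → runStart (i ∸ 2) ≤ n → n ≤ runStart i → target n ≡ profile i 0
    target-approach i coloured n lo hi with m≤n⇒m<n∨m≡n hi
    ... | inj₂ refl = trans (cong target (sym (+-identityʳ (runStart i)))) (target-on-run i 0 coloured (len-pos i))
    ... | inj₁ n<start = runTarget-gap i (run n) (offset n) coloured (m∸2≤n<m⇒m≡1+n∨m≡2+n i-2≤run run<i)
      where
      i-2≤run : i ∸ 2 ≤ run n
      i-2≤run = proj₁ (run-between {i ∸ 2} {i} lo n<start)
      run<i : run n < i
      run<i = proj₂ (run-between {i ∸ 2} {i} lo n<start)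

    agrees-from-start : ∀ i → colour i ≡ r → interpolant (runStart i) ≡ profile i 0 →
                        ∀ k → k < len i → interpolant (runStart i + k) ≡ profile i k
    agrees-from-start i coloured at-start k k<len =
      trans (pursuit-tracks target (runStart i) (len i) start-on-target unit-steps k k<len)
            (target-on-run i k coloured k<len)
      where
      start-on-target : interpolant (runStart i) ≡ target (runStart i)
      start-on-target = trans at-start
        (sym (target-approach i coloured (runStart i) (runStart-mono-≤ (m∸n≤m i 2)) ≤-refl))
      unit-steps : ∀ k → suc k < len i → ∣ target (suc (runStart i + k)) - target (runStart i + k) ∣ ≤ 1
      unit-steps k 1+k<len = subst₂ (λ x y → ∣ x - y ∣ ≤ 1)
        (trans (sym (target-on-run i (suc k) coloured 1+k<len)) (cong target (+-suc (runStart i) k)))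
        (sym (target-on-run i k coloured (<-trans (n<1+n k) 1+k<len)))
        (profile-steps i k)

    agrees-at-start-from-origin : ∀ i → colour i ≡ r → runStart (i ∸ 2) ≡ 0 → interpolant (runStart i) ≡ profile i 0
    agrees-at-start-from-origin i coloured origin = pursuit-reaches target 0 (runStart i)
      (λ k k<start → target-approach i coloured (suc k) (subst (_≤ suc k) (sym origin) z≤n) k<start)
      (≤-trans (≤-reflexive (trans (cong (λ x → ∣ x - profile i 0 ∣) at-origin) (∣n-n∣≡0 (profile i 0)))) z≤n)
      where
      at-origin : target 0 ≡ profile i 0
      at-origin = target-approach i coloured 0 (≤-reflexive origin) z≤n

    agrees-at-start : ∀ i → colour i ≡ r → interpolant (runStart i) ≡ profile i 0
    agrees-at-start 0 coloured = agrees-at-start-from-origin 0 coloured refl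
    agrees-at-start 1 coloured = agrees-at-start-from-origin 1 coloured refl
    agrees-at-start 2 coloured = agrees-at-start-from-origin 2 coloured refl
    agrees-at-start (suc (suc (suc j))) coloured =
      subst (λ n → interpolant n ≡ profile (3 + j) 0) last+1+gap≡start
        (pursuit-reaches target last (suc gap) constant-in-gap near-enough)
      where
      last gap : ℕ
      last = lastOfRun j
      gap  = len (1 + j) + len (2 + j)
      1+last+k≡ : ∀ k → suc (last + k) ≡ runStart (suc j) + k
      1+last+k≡ k = cong (_+ k) (suc-lastOfRun j)
      last+1+gap≡start : last + suc gap ≡ runStart (3 + j)
      last+1+gap≡start = trans (+-suc last gap)
        (trans (1+last+k≡ gap) (sym (+-assoc (runStart (suc j)) _ _)))
      constant-in-gap : ∀ k → k < suc gap → target (suc (last + k)) ≡ profile (3 + j) 0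
      constant-in-gap k k≤gap = target-approach (3 + j) coloured (suc (last + k))
        (subst (runStart (suc j) ≤_) (sym (1+last+k≡ k)) (m≤m+n _ k))
        (subst₂ _≤_ (sym (1+last+k≡ k)) (sym (+-assoc (runStart (suc j)) _ _))
          (+-monoʳ-≤ (runStart (suc j)) (s≤s⁻¹ k≤gap)))
      near-enough : ∣ interpolant last - profile (3 + j) 0 ∣ ≤ suc gap
      near-enough = subst (λ x → ∣ x - profile (3 + j) 0 ∣ ≤ suc gap)
        (sym (agrees-from-start j coloured (agrees-at-start j coloured) _ (pred-len<len j)))
        (m≤n⇒m≤1+n (profile-jump j coloured))

    interpolant-agrees : ∀ i → colour i ≡ r → ∀ k → k < len i → interpolant (runStart i + k) ≡ profile i k
    interpolant-agrees i coloured = agrees-from-start i coloured (agrees-at-start i coloured)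

fib : ℕ → ℕ
fib zero          = 1
fib (suc zero)    = 1
fib (suc (suc i)) = fib i + fib (suc i)

fib-pos : ∀ i → 0 < fib i
fib-pos zero          = s≤s z≤n
fib-pos (suc zero)    = s≤s z≤n
fib-pos (suc (suc i)) = ≤-trans (fib-pos i) (m≤m+n (fib i) _)

fib-≤-suc : ∀ i → fib i ≤ fib (suc i)
fib-≤-suc zero    = ≤-refl
fib-≤-suc (suc i) = m≤n+m (fib (suc i)) (fib i)

fib-suc≤2* : ∀ i → fib (suc i) ≤ 2 * fib i
fib-suc≤2* zero    = s≤s z≤n
fib-suc≤2* (suc i) = subst (fib (2 + i) ≤_) (cong (fib (suc i) +_) (sym (+-identityʳ (fib (suc i)))))
  (+-monoˡ-≤ (fib (suc i)) (fib-≤-suc i))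

fib-≤-3+ : ∀ i → fib i ≤ fib (3 + i)
fib-≤-3+ i = ≤-trans (fib-≤-suc i) (≤-trans (fib-≤-suc (suc i)) (fib-≤-suc (2 + i)))

open Runs fib fib-pos

suc-runStart-suc : ∀ i → suc (runStart (suc i)) ≡ fib (2 + i)
suc-runStart-suc zero    = refl
suc-runStart-suc (suc i) = begin
  suc (runStart (suc i) + fib (suc i))  ≡⟨ cong (_+ fib (suc i)) (suc-runStart-suc i) ⟩
  fib (2 + i) + fib (suc i)             ≡⟨ +-comm (fib (2 + i)) (fib (suc i)) ⟩
  fib (3 + i)                           ∎
  where open ≡-Reasoning

position<fib-run*3 : ∀ n → n < fib (run n) * 3
position<fib-run*3 n = begin-strict
  n                      ≡⟨ proj₁ (locate-sound n) ⟨
  runStart i + offset n  <⟨ +-monoʳ-< (runStart i) (proj₂ (locate-sound n)) ⟩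
  runStart (suc i)       <⟨ ≤-reflexive (suc-runStart-suc i) ⟩
  fib i + fib (suc i)    ≤⟨ +-monoʳ-≤ (fib i) (fib-suc≤2* i) ⟩
  3 * fib i              ≡⟨ *-comm 3 (fib i) ⟩
  fib i * 3              ∎
  where
  open ≤-Reasoning
  i : ℕ
  i = run n

triangle-jump : ∀ j → ∣ fib j ∸ suc (pred (fib j)) - fib (3 + j) ∸ 1 ∣ ≤ fib (3 + j)
triangle-jump j = begin
  ∣ fib j ∸ suc (pred (fib j)) - fib (3 + j) ∸ 1 ∣ ≡⟨ cong (λ x → ∣ fib j ∸ x - fib (3 + j) ∸ 1 ∣) (suc-pred-len j) ⟩
  ∣ fib j ∸ fib j - fib (3 + j) ∸ 1 ∣               ≡⟨ cong (λ x → ∣ x - fib (3 + j) ∸ 1 ∣) (n∸n≡0 (fib j)) ⟩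
  fib (3 + j) ∸ 1                                   ≤⟨ m∸n≤m (fib (3 + j)) 1 ⟩
  fib (3 + j)                                       ∎
  where open ≤-Reasoning


module _ (U : (ℕ → Set) → Set) (UF : IsUltrafilter U) where
  open IsUltrafilter UF

  ≗⇒≡[U] : ∀ {f g} → (∀ n → f n ≡ g n) → f ≡[ U ] g
  ≗⇒≡[U] f≗g = upward (λ n _ → f≗g n) whole

  ≡[U]-trans : ∀ {f g h} → f ≡[ U ] g → g ≡[ U ] h → f ≡[ U ] h
  ≡[U]-trans f≡g g≡h = upward (λ n (e₁ , e₂) → trans e₁ e₂) (meet f≡g g≡h)

  equivToNondecreasing-resp : ∀ {f g} → f ≡[ U ] g → EquivToNondecreasing U g → EquivToNondecreasing U f
  equivToNondecreasing-resp f≡g (h , h↑ , g≡h) = h , h↑ , ≡[U]-trans f≡g g≡h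

  +-*-equivToNondecreasing : ∀ {a b c} → EquivToNondecreasing U a → EquivToNondecreasing U b → Nondecreasing c →
                             EquivToNondecreasing U (λ n → a n + b n * c n)
  +-*-equivToNondecreasing {c = c} (a′ , a′↑ , a≡a′) (b′ , b′↑ , b≡b′) c↑ =
    (λ n → a′ n + b′ n * c n) ,
    (λ m n m≤n → +-mono-≤ (a′↑ m n m≤n) (*-mono-≤ (b′↑ m n m≤n) (c↑ m n m≤n))) ,
    upward (λ n (ea , eb) → cong₂ (λ x y → x + y * c n) ea eb) (meet a≡a′ b≡b′)

  bounded⇒U-constant : ∀ K (g : ℕ → ℕ) → (∀ n → g n ≤ K) → ∃ λ c → U (λ n → g n ≡ c)
  bounded⇒U-constant K g g≤K = bounded-on K (λ _ → ⊤) whole (λ n _ → g≤K n)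
    where
    bounded-on : ∀ K (A : ℕ → Set) → U A → (∀ n → A n → g n ≤ K) → ∃ λ c → U (λ n → g n ≡ c)
    bounded-on zero A A∈U g≤0 = 0 , upward (λ n a → n≤0⇒n≡0 (g≤0 n a)) A∈U
    bounded-on (suc K) A A∈U g≤1+K with ultra (λ n → g n ≡ suc K)
    ... | inj₁ g≡1+K = suc K , g≡1+K
    ... | inj₂ g≢1+K = bounded-on K _ (meet A∈U g≢1+K)
                         (λ n (a , g≢) → s≤s⁻¹ (≤∧≢⇒< (g≤1+K n a) g≢))

  tail∈U : IsNonprincipal U → ∀ m → U (m ≤_)
  tail∈U _  zero    = upward (λ _ _ → z≤n) whole
  tail∈U np (suc m) with ultra (_≡ m)
  ... | inj₁ ≡m∈U = ⊥-elim (np m ≡m∈U)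
  ... | inj₂ ≢m∈U = upward (λ n (m≤n , n≢m) → ≤∧≢⇒< m≤n (n≢m ∘ sym)) (meet (tail∈U np m) ≢m∈U)

  below-power⇒equivToNondecreasing : QuasiSelective U → ∀ K f → (∀ n → f n < suc n ^ K) →
                                     EquivToNondecreasing U f
  below-power⇒equivToNondecreasing qs zero f f<1 =
    (λ _ → 0) , (λ _ _ _ → z≤n) , ≗⇒≡[U] (λ n → n<1⇒n≡0 (f<1 n))
  below-power⇒equivToNondecreasing qs (suc K) f f<pow =
    equivToNondecreasing-resp (≗⇒≡[U] (λ n → m≡m%n+[m/n]*n (f n) (suc n)))
      (+-*-equivToNondecreasing
        (qs (λ n → f n % suc n) (λ n → s≤s⁻¹ (m%n<n (f n) (suc n))))
        (below-power⇒equivToNondecreasing qs K (λ n → f n / suc n)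
          (λ n → m<n*o⇒m/o<n (subst (f n <_) (*-comm (suc n) _) (f<pow n))))
        (λ _ _ → s≤s))

  quasiSelective⇒polynomialGrowth : IsNonprincipal U → QuasiSelective U →
                                    ∀ f → PolynomialGrowth f → EquivToNondecreasing U f
  quasiSelective⇒polynomialGrowth np qs f (k , m , f≤pow) =
    equivToNondecreasing-resp (upward agrees (tail∈U np (suc m)))
      (below-power⇒equivToNondecreasing qs (suc k) f-mod (λ n → m%n<n (f n) _ {{bound≢0 n}}))
    where
    bound≢0 : ∀ n → NonZero (suc n ^ suc k)
    bound≢0 n = m^n≢0 (suc n) (suc k)
    f-mod : ℕ → ℕ
    f-mod n = _%_ (f n) (suc n ^ suc k) {{bound≢0 n}}
    pow<pow : ∀ n → 0 < n → n ^ k < suc n ^ suc k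
    pow<pow n 0<n = begin-strict
      n ^ k                   ≤⟨ ^-monoˡ-≤ k (n≤1+n n) ⟩
      suc n ^ k               <⟨ m<m+n (suc n ^ k) (*-mono-≤ 0<n (m^n>0 (suc n) k)) ⟩
      suc n ^ k + n * suc n ^ k ∎
      where open ≤-Reasoning
    agrees : ∀ n → suc m ≤ n → f n ≡ f-mod n
    agrees n m<n = sym (m<n⇒m%n≡m {{bound≢0 n}}
      (≤-<-trans (f≤pow n m<n) (pow<pow n (≤-trans (s≤s z≤n) m<n))))

  polynomialGrowth⇒quasiSelective : (∀ f → PolynomialGrowth f → EquivToNondecreasing U f) → QuasiSelective U
  polynomialGrowth⇒quasiSelective poly f f≤id =
    poly f (1 , 0 , λ n _ → subst (f n ≤_) (sym (*-identityʳ n)) (f≤id n))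

  module _ (minimalSteps⇒ : ∀ f → MinimalSteps f → EquivToNondecreasing U f) where

    module ThinSet (r : ℕ) (coloured∈U : U (λ n → colour (run n) ≡ r)) where

      module Triangle = Interpolation r (λ i k → fib i ∸ suc k)
        (λ i k → ∣m∸1+n-m∸n∣≤1 (fib i) (suc k)) (λ j _ → triangle-jump j)

      triangle-equiv : EquivToNondecreasing U Triangle.interpolant
      triangle-equiv = minimalSteps⇒ Triangle.interpolant (pursuit-minimalSteps Triangle.target)

      g : ℕ → ℕ
      g = proj₁ triangle-equiv

      g↑ : Nondecreasing g
      g↑ = proj₁ (proj₂ triangle-equiv)

      Thin : ℕ → Set
      Thin n = colour (run n) ≡ r × Triangle.interpolant n ≡ g n

      thin? : ∀ n → Dec (Thin n)
      thin? n = (colour (run n) ≟ r) ×-dec (Triangle.interpolant n ≟ g n)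

      thin∈U : U Thin
      thin∈U = meet coloured∈U (proj₂ (proj₂ triangle-equiv))

      thin-unique< : ∀ i k k′ → k < k′ → k′ < fib i → Thin (runStart i + k) → ¬ Thin (runStart i + k′)
      thin-unique< i k k′ k<k′ k′<fib (coloured , on-k) (_ , on-k′) = <-irrefl refl (begin-strict
        g (runStart i + k′)                     ≡⟨ on-k′ ⟨
        Triangle.interpolant (runStart i + k′)  ≡⟨ Triangle.interpolant-agrees i i-coloured k′ k′<fib ⟩
        fib i ∸ suc k′                          <⟨ ∸-monoʳ-< (s≤s k<k′) k′<fib ⟩
        fib i ∸ suc k                           ≡⟨ Triangle.interpolant-agrees i i-coloured k k<fib ⟨
        Triangle.interpolant (runStart i + k)   ≡⟨ on-k ⟩
        g (runStart i + k)                      ≤⟨ g↑ _ _ (+-monoʳ-≤ (runStart i) (<⇒≤ k<k′)) ⟩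
        g (runStart i + k′)                     ∎)
        where
        open ≤-Reasoning
        k<fib : k < fib i
        k<fib = <-trans k<k′ k′<fib
        i-coloured : colour i ≡ r
        i-coloured = subst (λ j → colour j ≡ r) (run-runStart+ i k k<fib) coloured

      thin-unique : ∀ i k k′ → k < fib i → k′ < fib i →
                    Thin (runStart i + k) → Thin (runStart i + k′) → k ≡ k′
      thin-unique i k k′ k<fib k′<fib thin thin′ with <-cmp k k′
      ... | tri< k<k′ _ _ = ⊥-elim (thin-unique< i k k′ k<k′ k′<fib thin thin′)
      ... | tri≈ _ k≡k′ _ = k≡k′
      ... | tri> _ _ k′<k = ⊥-elim (thin-unique< i k′ k k′<k k<fib thin′ thin)

      module _ (F : ℕ → ℕ) (F≤fib : ∀ n → F n ≤ fib (run n)) where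

        sample : ℕ → ℕ
        sample i with anyUpTo? (λ k → thin? (runStart i + k)) (fib i)
        ... | yes (k , _ , _) = F (runStart i + k)
        ... | no _            = 0

        sample≤fib : ∀ i → sample i ≤ fib i
        sample≤fib i with anyUpTo? (λ k → thin? (runStart i + k)) (fib i)
        ... | yes (k , k<fib , _) = subst (λ j → F (runStart i + k) ≤ fib j) (run-runStart+ i k k<fib) (F≤fib _)
        ... | no _                = z≤n

        sample-thin : ∀ i k → k < fib i → Thin (runStart i + k) → sample i ≡ F (runStart i + k)
        sample-thin i k k<fib thin with anyUpTo? (λ k → thin? (runStart i + k)) (fib i)
        ... | yes (k′ , k′<fib , thin′) = cong (λ x → F (runStart i + x)) (thin-unique i k′ k k′<fib k<fib thin′ thin)
        ... | no none                  = ⊥-elim (none (k , k<fib , thin))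

        sample-jump : ∀ j → ∣ sample j - sample (3 + j) ∣ ≤ fib (3 + j)
        sample-jump j = ≤-trans (∣m-n∣≤m⊔n (sample j) _)
          (⊔-lub (≤-trans (sample≤fib j) (fib-≤-3+ j)) (sample≤fib (3 + j)))

        module Staircase = Interpolation r (λ i _ → sample i)
          (λ i _ → ≤-trans (≤-reflexive (∣n-n∣≡0 (sample i))) z≤n) (λ j _ → sample-jump j)

        thin⇒F≡staircase : ∀ n → Thin n → F n ≡ Staircase.interpolant n
        thin⇒F≡staircase n thin = begin
          F n
            ≡⟨ cong F n≡ ⟨
          F (runStart (run n) + offset n)
            ≡⟨ sample-thin (run n) (offset n) offset<fib (subst Thin (sym n≡) thin) ⟨
          sample (run n)
            ≡⟨ Staircase.interpolant-agrees (run n) (proj₁ thin) (offset n) offset<fib ⟨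
          Staircase.interpolant (runStart (run n) + offset n)
            ≡⟨ cong Staircase.interpolant n≡ ⟩
          Staircase.interpolant n
            ∎
          where
          open ≡-Reasoning
          n≡ : runStart (run n) + offset n ≡ n
          n≡ = proj₁ (locate-sound n)
          offset<fib : offset n < fib (run n)
          offset<fib = proj₂ (locate-sound n)

        fib-bounded⇒equivToNondecreasing : EquivToNondecreasing U F
        fib-bounded⇒equivToNondecreasing = equivToNondecreasing-resp (upward thin⇒F≡staircase thin∈U)
          (minimalSteps⇒ Staircase.interpolant (pursuit-minimalSteps Staircase.target))

    minimalSteps⇒quasiSelective : QuasiSelective U
    minimalSteps⇒quasiSelective f f≤id
      with bounded⇒U-constant 2 (λ n → colour (run n)) (λ n → colour≤2 (run n))
         | bounded⇒U-constant 2 (λ n → f n % 3) (λ n → s≤s⁻¹ (m%n<n (f n) 3))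
    ... | r , coloured∈U | c , f%3≡c =
      equivToNondecreasing-resp (≗⇒≡[U] (λ n → m≡m%n+[m/n]*n (f n) 3))
        (+-*-equivToNondecreasing ((λ _ → c) , (λ _ _ _ → ≤-refl) , f%3≡c)
          (ThinSet.fib-bounded⇒equivToNondecreasing r coloured∈U (λ n → f n / 3)
            (λ n → <⇒≤ (m<n*o⇒m/o<n (≤-<-trans (f≤id n) (position<fib-run*3 n)))))
          (λ _ _ _ → ≤-refl))

proposition1p3 : (U : (ℕ → Set) → Set) → IsUltrafilter U → IsNonprincipal U →
    (QuasiSelective U ⇔ (∀ (f : ℕ → ℕ) → PolynomialGrowth f → EquivToNondecreasing U f))
    × (QuasiSelective U ⇔ (∀ (f : ℕ → ℕ) → MinimalSteps f → EquivToNondecreasing U f))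
proposition1p3 U UF NP =
  mk⇔ (quasiSelective⇒polynomialGrowth U UF NP) (polynomialGrowth⇒quasiSelective U UF) ,
  mk⇔ (λ qs f unit → quasiSelective⇒polynomialGrowth U UF NP qs f (minimalSteps⇒polynomialGrowth f unit))
      (minimalSteps⇒quasiSelective U UF)
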